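{- Let $\mathbf A$ be a subdirectly irreducible algebra in a congruence permutable Fregean variety $\mathcal V$, with $\ast$ the largest element of $A\setminus\{1\}$ (so the monolith has $1$-coset $\{\ast,1\}$), and write $ab$ for $a\leftrightarrow b$ with $\leftrightarrow$ the term described in the context. Then: (1) $a\ast=a$ for every $a\in A\setminus\{\ast,1\}$; (2) $A\setminus\{\ast\}$ is closed under the operation $\leftrightarrow$.
   Context: A variety $\mathcal V$ with a distinguished constant $1$ is Fregean if every algebra in it is $1$-regular (congruences with the same $1$-coset are equal) and congruence orderable ($\Theta(1,a)=\Theta(1,b)$ implies $a=b$). In a Fregean variety, $\mathbf A$ is subdirectly irreducible iff $A\setminus\{1\}$ has a largest element $\ast$ in the order $a\le b\iff\Theta(1,b)\subseteq\Theta(1,a)$; the monolith then has $1$-coset $\{\ast,1\}$ and all its other cosets are singletons. It is known that in a congruence permutable Fregean variety there is a binary term $\leftrightarrow$ such that for every $\mathbf A\in\mathcal V$, $(A,\leftrightarrow,1)$ is an equivalential algebra (subreduct of a Heyting algebra with $x\leftrightarrow y=(x\to y)\wedge(y\to x)$) and for every congruence $\theta$, $a\,\theta\,b$ iff $(a\leftrightarrow b)\,\theta\,1$; fix such a term. -}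

module Defs where

open import Level using (0ℓ)
open import Data.Nat using (ℕ)
open import Data.Fin using (Fin; zero; suc)
open import Data.Product using (Σ; _×_; _,_)
open import Relation.Binary.PropositionalEquality using (_≡_; _≢_)
open import Relation.Binary.Lattice.Bundles using (HeytingAlgebra)

record Signature : Set₁ where
  field
    Op    : Set
    arity : Op → ℕ
open Signature public

module _ (σ : Signature) where

  data Term (X : Set) : Set where
    var  : X → Term X
    node : (f : Op σ) → (Fin (arity σ f) → Term X) → Term X

  record Algebra : Set₁ where
    field
      Carrier : Set
      op      : (f : Op σ) → (Fin (arity σ f) → Carrier) → Carrier
  open Algebra public

  eval : (A : Algebra) {X : Set} → Term X → (X → Carrier A) → Carrier A
  eval A (var x)     ρ = ρ x
  eval A (node f ts) ρ = op A f (λ i → eval A (ts i) ρ)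

  -- a variety, given (Birkhoff) by a set of equations in variables from ℕ
  record Variety : Set₁ where
    field
      Eqn : Set
      lhs : Eqn → Term ℕ
      rhs : Eqn → Term ℕ

  _∈V_ : Algebra → Variety → Set
  A ∈V V = ∀ (e : Variety.Eqn V) (ρ : ℕ → Carrier A) →
           eval A (Variety.lhs V e) ρ ≡ eval A (Variety.rhs V e) ρ

  record Congruence (A : Algebra) : Set₁ where
    field
      rel    : Carrier A → Carrier A → Set
      reflC  : ∀ x → rel x x
      symC   : ∀ {x y} → rel x y → rel y x
      transC : ∀ {x y z} → rel x y → rel y z → rel x z
      compat : ∀ (f : Op σ) (xs ys : Fin (arity σ f) → Carrier A) →
               (∀ i → rel (xs i) (ys i)) → rel (op A f xs) (op A f ys)
  open Congruence public

  _⊆ᵣ_ : ∀ {a ℓ₁ ℓ₂} {C : Set a} → (C → C → Set ℓ₁) → (C → C → Set ℓ₂) → Set _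
  R ⊆ᵣ S = ∀ {x y} → R x y → S x y

  _≐ᵣ_ : ∀ {a ℓ₁ ℓ₂} {C : Set a} → (C → C → Set ℓ₁) → (C → C → Set ℓ₂) → Set _
  R ≐ᵣ S = (R ⊆ᵣ S) × (S ⊆ᵣ R)

  -- Θ(a,b): the congruence generated by (a,b), i.e. the intersection of
  -- all congruences containing (a,b)
  Θ : (A : Algebra) → Carrier A → Carrier A → Carrier A → Carrier A → Set₁
  Θ A a b x y = ∀ (θ : Congruence A) → rel θ a b → rel θ x y

  _∘ᵣ_ : {C : Set} → (C → C → Set) → (C → C → Set) → C → C → Set
  (R ∘ᵣ S) x z = Σ _ λ y → R x y × S y z

  module _ (one : Term (Fin 0)) where

    𝟙 : (A : Algebra) → Carrier A
    𝟙 A = eval A one (λ ())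

    OneRegular : Algebra → Set₁
    OneRegular A = ∀ (θ φ : Congruence A) →
      (∀ x → (rel θ x (𝟙 A) → rel φ x (𝟙 A)) × (rel φ x (𝟙 A) → rel θ x (𝟙 A))) →
      rel θ ≐ᵣ rel φ

    CongruenceOrderable : Algebra → Set₁
    CongruenceOrderable A = ∀ a b → Θ A (𝟙 A) a ≐ᵣ Θ A (𝟙 A) b → a ≡ b

    Fregean : Variety → Set₁
    Fregean V = ∀ (A : Algebra) → A ∈V V → OneRegular A × CongruenceOrderable A

    Leq : (A : Algebra) → Carrier A → Carrier A → Set₁
    Leq A a b = Θ A (𝟙 A) b ⊆ᵣ Θ A (𝟙 A) a

  CongruencePermutable : Variety → Set₁
  CongruencePermutable V = ∀ (A : Algebra) → A ∈V V → ∀ (θ φ : Congruence A) →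
    (rel θ ∘ᵣ rel φ) ≐ᵣ (rel φ ∘ᵣ rel θ)

  -- subdirectly irreducible: the intersection of all non-identity
  -- congruences is not the identity (there is a monolith)
  SubdirectlyIrreducible : Algebra → Set₁
  SubdirectlyIrreducible A = Σ (Carrier A) λ a → Σ (Carrier A) λ b → a ≢ b ×
    (∀ (θ : Congruence A) → (Σ (Carrier A) λ c → Σ (Carrier A) λ d → c ≢ d × rel θ c d) →
     rel θ a b)

  binop : (A : Algebra) → Term (Fin 2) → Carrier A → Carrier A → Carrier A
  binop A t x y = eval A t (λ { zero → x ; (suc zero) → y })

  -- (A, t, 1) is an equivalential algebra: a subreduct of a Heyting algebra
  -- with x ↔ y = (x → y) ∧ (y → x), and 1 = ⊤
  IsEquivalential : (A : Algebra) → (Carrier A → Carrier A → Carrier A) → Carrier A → Set₁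
  IsEquivalential A _↔_ e = Σ (HeytingAlgebra 0ℓ 0ℓ 0ℓ) λ H →
    let open HeytingAlgebra H renaming (Carrier to |H|) in
    Σ (Carrier A → |H|) λ h →
      (∀ x y → h x ≈ h y → x ≡ y) ×
      (∀ x y → h (x ↔ y) ≈ ((h x ⇨ h y) ∧ (h y ⇨ h x))) ×
      (h e ≈ ⊤)

-- Part (1): if a ∉ {∗, 1}, each of Θ(1, a) and Θ(1, a ↔ ∗) identifies ∗ with 1, and
-- modulo any such congruence a ↔ ∗ is congruent to a ↔ 1 = a.  Hence the two principal
-- congruences coincide, and congruence orderability gives a ↔ ∗ = a.
-- Part (2): if a ↔ b = ∗ with a, b ≠ ∗, then a, b ≠ 1 since 1 is a unit for ↔, so by (1)
-- a ↔ ∗ = a and b ↔ ∗ = b, i.e. a, b ≤ ∗ = a ↔ b in the ambient Heyting algebra; this forces a = b and so ∗ = 1.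

module Submission where

open import Defs
open import Data.Fin using (Fin; zero; suc)
open import Data.Product using (_×_; _,_; proj₁; proj₂)
open import Relation.Binary.PropositionalEquality as ≡ using (_≡_; _≢_)
open import Relation.Binary.Lattice.Bundles using (HeytingAlgebra)
import Relation.Binary.Lattice.Properties.HeytingAlgebra as HeytingProperties
import Relation.Binary.Lattice.Properties.MeetSemilattice as MeetProperties
import Relation.Binary.Reasoning.PartialOrder as ≤-Reasoning
import Relation.Binary.Reasoning.Setoid as ≈-Reasoning

module Biimplication {c ℓ₁ ℓ₂} (H : HeytingAlgebra c ℓ₁ ℓ₂) where
  open HeytingAlgebra H renaming (Carrier to |H|)
  open HeytingProperties H using (y≤x⇨y; ⇨-cong)
  open MeetProperties meetSemilattice using (∧-comm; ∧-cong)
  open ≤-Reasoning poset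

  infix 5 _⇔_
  _⇔_ : |H| → |H| → |H|
  x ⇔ y = (x ⇨ y) ∧ (y ⇨ x)

  ⇔-cong : ∀ {x x′ y y′} → x ≈ x′ → y ≈ y′ → x ⇔ y ≈ x′ ⇔ y′
  ⇔-cong x≈x′ y≈y′ = ∧-cong (⇨-cong x≈x′ y≈y′) (⇨-cong y≈y′ x≈x′)

  ⇔-comm : ∀ x y → x ⇔ y ≈ y ⇔ x
  ⇔-comm x y = ∧-comm (x ⇨ y) (y ⇨ x)

  ⇔-identityʳ : ∀ x → x ⇔ ⊤ ≈ x
  ⇔-identityʳ x = antisym
    (begin
      (x ⇨ ⊤) ∧ (⊤ ⇨ x) ≤⟨ x∧y≤y _ _ ⟩
      ⊤ ⇨ x             ≤⟨ ∧-greatest refl (maximum _) ⟩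
      (⊤ ⇨ x) ∧ ⊤       ≤⟨ transpose-∧ refl ⟩
      x                 ∎)
    (∧-greatest (transpose-⇨ (maximum _)) y≤x⇨y)

  ⇔-identityˡ : ∀ x → ⊤ ⇔ x ≈ x
  ⇔-identityˡ x = Eq.trans (⇔-comm ⊤ x) (⇔-identityʳ x)

  modus-ponens : ∀ {x y} → x ≤ x ⇨ y → x ≤ y
  modus-ponens {x} {y} x≤x⇨y = begin
    x     ≤⟨ ∧-greatest refl refl ⟩
    x ∧ x ≤⟨ transpose-∧ x≤x⇨y ⟩
    y     ∎

  ≤⇔⇒≤ : ∀ {x y} → x ≤ x ⇔ y → x ≤ y
  ≤⇔⇒≤ x≤x⇔y = modus-ponens (trans x≤x⇔y (x∧y≤x _ _))

  ⇔≈⊤⇒≈ : ∀ {x y} → x ⇔ y ≈ ⊤ → x ≈ y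
  ⇔≈⊤⇒≈ {x} {y} x⇔y≈⊤ =
    antisym (≤⇔⇒≤ (below-⇔ x)) (≤⇔⇒≤ (trans (below-⇔ y) (reflexive (⇔-comm x y))))
    where
    below-⇔ : ∀ z → z ≤ x ⇔ y
    below-⇔ z = trans (maximum z) (reflexive (Eq.sym x⇔y≈⊤))

  ⇔-fixes⇒≤ : ∀ {x z} → x ⇔ z ≈ x → x ≤ z
  ⇔-fixes⇒≤ x⇔z≈x = ≤⇔⇒≤ (reflexive (Eq.sym x⇔z≈x))

  ⇔-upperBound⇒≈⊤ : ∀ {x y} → x ≤ x ⇔ y → y ≤ x ⇔ y → x ⇔ y ≈ ⊤
  ⇔-upperBound⇒≈⊤ {x} {y} x≤x⇔y y≤x⇔y = antisym (maximum _)
    (∧-greatest (transpose-⇨ (trans (x∧y≤y _ _) x≤y))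
                (transpose-⇨ (trans (x∧y≤y _ _) y≤x)))
    where
    x≤y : x ≤ y
    x≤y = ≤⇔⇒≤ x≤x⇔y
    y≤x : y ≤ x
    y≤x = ≤⇔⇒≤ (trans y≤x⇔y (reflexive (⇔-comm x y)))

module Equivalential {σ : Signature} (A : Algebra σ)
  (_↔_ : Carrier A → Carrier A → Carrier A) (e : Carrier A)
  (isEquivalential : IsEquivalential σ A _↔_ e) where

  private
    H = proj₁ isEquivalential
    open HeytingAlgebra H using (_≈_; _≤_; ⊤; module Eq; setoid; reflexive; trans)
    open Biimplication H
    open ≈-Reasoning setoid

    h : Carrier A → HeytingAlgebra.Carrier H
    h = proj₁ (proj₂ isEquivalential)

    h-reflects-≈ : ∀ {a b} → h a ≈ h b → a ≡ b
    h-reflects-≈ = proj₁ (proj₂ (proj₂ isEquivalential)) _ _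

    h-↔ : ∀ a b → h (a ↔ b) ≈ h a ⇔ h b
    h-↔ = proj₁ (proj₂ (proj₂ (proj₂ isEquivalential)))

    h-e : h e ≈ ⊤
    h-e = proj₂ (proj₂ (proj₂ (proj₂ isEquivalential)))

    h-≡ : ∀ {a b} → a ≡ b → h a ≈ h b
    h-≡ ≡.refl = Eq.refl

  ↔-identityʳ : ∀ a → a ↔ e ≡ a
  ↔-identityʳ a = h-reflects-≈ (begin
    h (a ↔ e) ≈⟨ h-↔ a e ⟩
    h a ⇔ h e ≈⟨ ⇔-cong Eq.refl h-e ⟩
    h a ⇔ ⊤   ≈⟨ ⇔-identityʳ (h a) ⟩
    h a       ∎)

  ↔-identityˡ : ∀ a → e ↔ a ≡ a
  ↔-identityˡ a = h-reflects-≈ (begin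
    h (e ↔ a) ≈⟨ h-↔ e a ⟩
    h e ⇔ h a ≈⟨ ⇔-cong h-e Eq.refl ⟩
    ⊤ ⇔ h a   ≈⟨ ⇔-identityˡ (h a) ⟩
    h a       ∎)

  ↔≡e⇒≡ : ∀ {a b} → a ↔ b ≡ e → a ≡ b
  ↔≡e⇒≡ {a} {b} a↔b≡e = h-reflects-≈ (⇔≈⊤⇒≈ (begin
    h a ⇔ h b ≈⟨ Eq.sym (h-↔ a b) ⟩
    h (a ↔ b) ≈⟨ h-≡ a↔b≡e ⟩
    h e       ≈⟨ h-e ⟩
    ⊤         ∎))

  ↔-upperBound⇒≡e : ∀ {a b c} → a ↔ c ≡ a → b ↔ c ≡ b → a ↔ b ≡ c → c ≡ e
  ↔-upperBound⇒≡e {a} {b} {c} a↔c≡a b↔c≡b a↔b≡c = h-reflects-≈ (begin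
    h c       ≈⟨ h-c ⟩
    h a ⇔ h b ≈⟨ ⇔-upperBound⇒≈⊤ (below-h-c a↔c≡a) (below-h-c b↔c≡b) ⟩
    ⊤         ≈⟨ Eq.sym h-e ⟩
    h e       ∎)
    where
    h-c : h c ≈ h a ⇔ h b
    h-c = Eq.trans (h-≡ (≡.sym a↔b≡c)) (h-↔ a b)

    below-h-c : ∀ {x} → x ↔ c ≡ x → h x ≤ h a ⇔ h b
    below-h-c {x} x↔c≡x =
      trans (⇔-fixes⇒≤ (Eq.trans (Eq.sym (h-↔ x c)) (h-≡ x↔c≡x))) (reflexive h-c)

module Congruences {σ : Signature} (A : Algebra σ) where

  eval-compat : (θ : Congruence σ A) {X : Set} (t : Term σ X) {ρ ρ′ : X → Carrier A} →
    (∀ x → rel θ (ρ x) (ρ′ x)) → rel θ (eval σ A t ρ) (eval σ A t ρ′)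
  eval-compat θ (var x)     ρθρ′ = ρθρ′ x
  eval-compat θ (node f ts) ρθρ′ = compat θ f _ _ (λ i → eval-compat θ (ts i) ρθρ′)

  binop-compat : (θ : Congruence σ A) (t : Term σ (Fin 2)) {a a′ b b′ : Carrier A} →
    rel θ a a′ → rel θ b b′ → rel θ (binop σ A t a b) (binop σ A t a′ b′)
  binop-compat θ t aθa′ bθb′ = eval-compat θ t λ { zero → aθa′ ; (suc zero) → bθb′ }

  Θ-antitone : ∀ {a b c d} → (∀ θ → rel θ a b → rel θ c d) →
    ∀ {x y} → Θ σ A c d x y → Θ σ A a b x y
  Θ-antitone ab⇒cd xy∈Θcd θ ab∈θ = xy∈Θcd θ (ab⇒cd θ ab∈θ)

  Leq⇒rel : (one : Term σ (Fin 0)) {a b : Carrier A} → Leq σ one A a b →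
    ∀ θ → rel θ (𝟙 σ one A) a → rel θ (𝟙 σ one A) b
  Leq⇒rel one a≤b θ = a≤b (λ _ 1θb → 1θb) θ

module LargestNonUnit {σ : Signature} (one : Term σ (Fin 0)) (eqv : Term σ (Fin 2))
  (A : Algebra σ)
  (isEquivalential : IsEquivalential σ A (binop σ A eqv) (𝟙 σ one A))
  (orderable : CongruenceOrderable σ one A)
  (∗ : Carrier A) (∗≢𝟏 : ∗ ≢ 𝟙 σ one A)
  (∗-largest : ∀ a → a ≢ 𝟙 σ one A → Leq σ one A a ∗) where

  open Congruences A

  private
    𝟏 : Carrier A
    𝟏 = 𝟙 σ one A

    _↔_ : Carrier A → Carrier A → Carrier A
    _↔_ = binop σ A eqv

  open Equivalential A _↔_ 𝟏 isEquivalential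

  ↔∗-related : ∀ θ → rel θ 𝟏 ∗ → ∀ a → rel θ (a ↔ ∗) a
  ↔∗-related θ 1θ∗ a =
    ≡.subst (rel θ (a ↔ ∗)) (↔-identityʳ a) (binop-compat θ eqv (reflC θ a) (symC θ 1θ∗))

  ↔∗-identity : ∀ a → a ≢ ∗ → a ≢ 𝟏 → a ↔ ∗ ≡ a
  ↔∗-identity a a≢∗ a≢𝟏 = ≡.sym (orderable a (a ↔ ∗) (Θ-antitone 1θa , Θ-antitone 1θa↔∗))
    where
    a↔∗≢𝟏 : a ↔ ∗ ≢ 𝟏
    a↔∗≢𝟏 a↔∗≡𝟏 = a≢∗ (↔≡e⇒≡ a↔∗≡𝟏)

    1θa↔∗ : ∀ θ → rel θ 𝟏 a → rel θ 𝟏 (a ↔ ∗)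
    1θa↔∗ θ 1θa = transC θ 1θa (symC θ (↔∗-related θ (Leq⇒rel one (∗-largest a a≢𝟏) θ 1θa) a))

    1θa : ∀ θ → rel θ 𝟏 (a ↔ ∗) → rel θ 𝟏 a
    1θa θ 1θa↔∗ = transC θ 1θa↔∗ (↔∗-related θ (Leq⇒rel one (∗-largest _ a↔∗≢𝟏) θ 1θa↔∗) a)

  ↔-avoids-∗ : ∀ a b → a ≢ ∗ → b ≢ ∗ → a ↔ b ≢ ∗
  ↔-avoids-∗ a b a≢∗ b≢∗ a↔b≡∗ =
    ∗≢𝟏 (↔-upperBound⇒≡e (↔∗-identity a a≢∗ a≢𝟏) (↔∗-identity b b≢∗ b≢𝟏) a↔b≡∗)
    where
    a≢𝟏 : a ≢ 𝟏
    a≢𝟏 ≡.refl = b≢∗ (≡.trans (≡.sym (↔-identityˡ b)) a↔b≡∗)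

    b≢𝟏 : b ≢ 𝟏
    b≢𝟏 ≡.refl = a≢∗ (≡.trans (≡.sym (↔-identityʳ a)) a↔b≡∗)

mainTheorem13 : (σ : Signature) (V : Variety σ) (one : Term σ (Fin 0))
    (eqv : Term σ (Fin 2)) →
    Fregean σ one V →
    CongruencePermutable σ V →
    (∀ (B : Algebra σ) → _∈V_ σ B V →
      IsEquivalential σ B (binop σ B eqv) (𝟙 σ one B) ×
      (∀ (θ : Congruence σ B) (a b : Algebra.Carrier B) →
        (rel θ a b → rel θ (binop σ B eqv a b) (𝟙 σ one B)) ×
        (rel θ (binop σ B eqv a b) (𝟙 σ one B) → rel θ a b))) →
    (A : Algebra σ) → _∈V_ σ A V → SubdirectlyIrreducible σ A →
    (s : Algebra.Carrier A) → s ≢ 𝟙 σ one A →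
    (∀ a → a ≢ 𝟙 σ one A → Leq σ one A a s) →
    (∀ a → a ≢ s → a ≢ 𝟙 σ one A → binop σ A eqv a s ≡ a) ×
    (∀ a b → a ≢ s → b ≢ s → binop σ A eqv a b ≢ s)
mainTheorem13 σ V one eqv fregean _ equivalential A A∈V _ s s≢𝟏 s-largest =
  ↔∗-identity , ↔-avoids-∗
  where
  open LargestNonUnit one eqv A (proj₁ (equivalential A A∈V)) (proj₂ (fregean A A∈V)) s s≢𝟏 s-largest
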